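{- Let $\Delta=({\mathcal V},{\mathcal D})$ be a digraph, and let $\tau$ and $\mu$ be the permutations of ${\mathcal V}\times{\mathcal V}\times\mathbb Z_2$ defined by $(a,x,i)^\tau=(x,a,1-i)$ and $(a,x,i)^\mu=(x,a,i)$. Then $\tau$ is a symmetry of $\mathrm{SBP}(\Delta,\Delta)$ and $\mu$ is a reversal of $\mathrm{SBP}(\Delta,\Delta^{ -1})$.
   Context: A digraph is a pair $({\mathcal V},{\mathcal D})$ with ${\mathcal V}$ a finite non-empty set and ${\mathcal D}$ a set of ordered pairs of distinct vertices (darts). A symmetry is a vertex permutation preserving the dart set. The reverse of $\Gamma=({\mathcal V},{\mathcal D})$ is $\Gamma^{ -1}=({\mathcal V},{\mathcal D}^{ -1})$ with ${\mathcal D}^{ -1}=\{(v,u):(u,v)\in{\mathcal D}\}$; a reversal of $\Gamma$ is an isomorphism $\Gamma\to\Gamma^{ -1}$. For digraphs $\Gamma_1=({\mathcal V}_1,{\mathcal D}_1)$, $\Gamma_2=({\mathcal V}_2,{\mathcal D}_2)$, $\mathrm{SBP}(\Gamma_1,\Gamma_2)$ has vertex set ${\mathcal V}_1\times{\mathcal V}_2\times\mathbb Z_2$ and darts all $((a,x,0),(b,x,1))$ with $(a,b)\in{\mathcal D}_1$, $x\in{\mathcal V}_2$, and all $((a,x,1),(a,y,0))$ with $a\in{\mathcal V}_1$, $(x,y)\in{\mathcal D}_2$. -}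

module Defs where

open import Data.Fin using (Fin; zero; suc)
open import Data.Product using (_×_; _,_)
open import Data.Sum using (_⊎_)
open import Relation.Nullary using (¬_)
open import Relation.Binary.PropositionalEquality using (_≡_; refl; cong)
open import Function.Bundles using (_↔_; _⇔_; mk↔ₛ′; Inverse)

record Digraph (V : Set) : Set₁ where
  field
    Dart     : V → V → Set
    loopless : ∀ {u} → ¬ Dart u u
open Digraph public

reverse : ∀ {V} → Digraph V → Digraph V
reverse Γ = record { Dart = λ u v → Dart Γ v u ; loopless = loopless Γ }

IsIso : ∀ {V} → Digraph V → Digraph V → V ↔ V → Set
IsIso {V} Γ₁ Γ₂ f = ∀ (u v : V) → Dart Γ₁ u v ⇔ Dart Γ₂ (to u) (to v)
  where open Inverse f

IsSymmetry : ∀ {V} → Digraph V → V ↔ V → Set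
IsSymmetry Γ f = IsIso Γ Γ f

IsReversal : ∀ {V} → Digraph V → V ↔ V → Set
IsReversal Γ f = IsIso Γ (reverse Γ) f

ℤ₂ : Set
ℤ₂ = Fin 2

1-_ : ℤ₂ → ℤ₂
1- zero = suc zero
1- suc zero = zero

SBPDart : ∀ {V₁ V₂} → Digraph V₁ → Digraph V₂ → (V₁ × V₂ × ℤ₂) → (V₁ × V₂ × ℤ₂) → Set
SBPDart Γ₁ Γ₂ (a , x , i) (b , y , j) =
    (i ≡ zero × j ≡ suc zero × x ≡ y × Dart Γ₁ a b)
  ⊎ (i ≡ suc zero × j ≡ zero × a ≡ b × Dart Γ₂ x y)

private
  sbp-loopless : ∀ {V₁ V₂} (Γ₁ : Digraph V₁) (Γ₂ : Digraph V₂) {u} → ¬ SBPDart Γ₁ Γ₂ u u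
  sbp-loopless Γ₁ Γ₂ (Data.Sum.inj₁ (refl , () , _))
  sbp-loopless Γ₁ Γ₂ (Data.Sum.inj₂ (refl , () , _))

SBP : ∀ {V₁ V₂} → Digraph V₁ → Digraph V₂ → Digraph (V₁ × V₂ × ℤ₂)
SBP Γ₁ Γ₂ = record { Dart = SBPDart Γ₁ Γ₂ ; loopless = sbp-loopless Γ₁ Γ₂ }

private
  1-1- : ∀ i → 1- (1- i) ≡ i
  1-1- zero = refl
  1-1- (suc zero) = refl

  τ-fun : ∀ {V : Set} → V × V × ℤ₂ → V × V × ℤ₂
  τ-fun (a , x , i) = (x , a , 1- i)

  τ-inv : ∀ {V : Set} (u : V × V × ℤ₂) → τ-fun (τ-fun u) ≡ u
  τ-inv (a , x , i) = cong {A = ℤ₂} (λ j → (a , x , j)) (1-1- i)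

  μ-fun : ∀ {V : Set} → V × V × ℤ₂ → V × V × ℤ₂
  μ-fun (a , x , i) = (x , a , i)

  μ-inv : ∀ {V : Set} (u : V × V × ℤ₂) → μ-fun (μ-fun u) ≡ u
  μ-inv (a , x , i) = refl

τ : ∀ {V : Set} → (V × V × ℤ₂) ↔ (V × V × ℤ₂)
τ = mk↔ₛ′ τ-fun τ-fun τ-inv τ-inv

μ : ∀ {V : Set} → (V × V × ℤ₂) ↔ (V × V × ℤ₂)
μ = mk↔ₛ′ μ-fun μ-fun μ-inv μ-inv

-- A dart of SBP(Δ,Δ) either moves the first coordinate along Δ from layer 0
-- to layer 1, or the second coordinate along Δ from layer 1 to layer 0.
-- Swapping the coordinates and the layers exchanges these two kinds of darts.
-- In SBP(Δ,Δ⁻¹) the second kind runs along Δ backwards, so swapping only the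
-- coordinates turns each dart of one kind into the reverse of a dart of the other.
module Submission where

open import Defs
open import Data.Nat using (ℕ; suc)
open import Data.Fin using (Fin; zero; suc)
open import Data.Product using (_×_; _,_)
open import Data.Sum using (inj₁; inj₂)
open import Relation.Binary.PropositionalEquality using (refl)
open import Function.Bundles using (Inverse; mk⇔)

module _ {V : Set} (Δ : Digraph V) where
  τ′ μ′ : V × V × ℤ₂ → V × V × ℤ₂
  τ′ = Inverse.to τ
  μ′ = Inverse.to μ

  τ-preserves-darts : ∀ u v → SBPDart Δ Δ u v → SBPDart Δ Δ (τ′ u) (τ′ v)
  τ-preserves-darts (_ , _ , _) (_ , _ , _) (inj₁ (refl , refl , refl , d)) = inj₂ (refl , refl , refl , d)
  τ-preserves-darts (_ , _ , _) (_ , _ , _) (inj₂ (refl , refl , refl , d)) = inj₁ (refl , refl , refl , d)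

  -- The layers of u and v must be split so that 1- reduces.
  τ-reflects-darts : ∀ u v → SBPDart Δ Δ (τ′ u) (τ′ v) → SBPDart Δ Δ u v
  τ-reflects-darts (_ , _ , zero)     (_ , _ , zero)     (inj₂ (_ , () , _))
  τ-reflects-darts (_ , _ , zero)     (_ , _ , suc zero) (inj₂ (refl , refl , refl , d)) = inj₁ (refl , refl , refl , d)
  τ-reflects-darts (_ , _ , suc zero) (_ , _ , zero)     (inj₁ (refl , refl , refl , d)) = inj₂ (refl , refl , refl , d)
  τ-reflects-darts (_ , _ , suc zero) (_ , _ , suc zero) (inj₁ (_ , () , _))

  τ-isSymmetry : IsSymmetry (SBP Δ Δ) τ
  τ-isSymmetry u v = mk⇔ (τ-preserves-darts u v) (τ-reflects-darts u v)

  μ-reverses-darts : ∀ u v → SBPDart Δ (reverse Δ) u v → SBPDart Δ (reverse Δ) (μ′ v) (μ′ u)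
  μ-reverses-darts (_ , _ , _) (_ , _ , _) (inj₁ (refl , refl , refl , d)) = inj₂ (refl , refl , refl , d)
  μ-reverses-darts (_ , _ , _) (_ , _ , _) (inj₂ (refl , refl , refl , d)) = inj₁ (refl , refl , refl , d)

  μ-unreverses-darts : ∀ u v → SBPDart Δ (reverse Δ) (μ′ v) (μ′ u) → SBPDart Δ (reverse Δ) u v
  μ-unreverses-darts (_ , _ , _) (_ , _ , _) (inj₁ (refl , refl , refl , d)) = inj₂ (refl , refl , refl , d)
  μ-unreverses-darts (_ , _ , _) (_ , _ , _) (inj₂ (refl , refl , refl , d)) = inj₁ (refl , refl , refl , d)

  μ-isReversal : IsReversal (SBP Δ (reverse Δ)) μ
  μ-isReversal u v = mk⇔ (μ-reverses-darts u v) (μ-unreverses-darts u v)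

lemma3p3 : (n : ℕ) (Δ : Digraph (Fin (suc n)))
    → IsSymmetry (SBP Δ Δ) τ × IsReversal (SBP Δ (reverse Δ)) μ
lemma3p3 _ Δ = τ-isSymmetry Δ , μ-isReversal Δ
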